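{- Let $a\in\{1,-1\}$. Then $G(A,\mathrm{O}(A))=0$ for $A=V$, $A=A_{2,1}\oplus A_{2,-1}$ and $A=(A_{2,a})^{\oplus3}$, and $G(A,\mathrm{O}(A))=\sqrt{|A|}$ for $A=(A_{2,a})^{\oplus2}$ and $A=(A_{2,a})^{\oplus4}$.
   Context: A finite quadratic form is a finite abelian group $A$ with $q:A\to\mathbb{Q}/\mathbb{Z}$ such that $q(nx)=n^2q(x)$ and $(x,y):=q(x+y)-q(x)-q(y)$ is a nondegenerate symmetric bilinear form; $\mathrm{O}(A)$ is its isometry group, $e(z)=\exp(2\pi iz)$, and $G(A,\Gamma)=\sum_{[x]\in\Gamma\backslash A}\sum_{y\in\Gamma x}e((x,y))$. $A_{2,a}$ is $\mathbb{Z}/2$ with $q(1)=a/4\bmod\mathbb{Z}$. $V$ is the form on $(\mathbb{Z}/2)^2$ with basis $v_1,v_2$, $q(v_1)=q(v_2)=1/2$, $(v_1,v_2)=1/2$. Direct sums are orthogonal. -}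

module Defs where

-- Finite quadratic forms on elementary abelian 2-groups (Z/2)^n.
-- All forms in Proposition 4.5 live on such groups and have q with values in
-- (1/4)Z/Z, so a form is recorded by q in "quarters": q x = k means q(x) = k/4 mod Z.

open import Data.Bool using (Bool; true; false; _xor_; _∧_; _∨_; not; if_then_else_)
open import Data.Nat using (ℕ; zero; suc; _+_; _*_; _^_; _≡ᵇ_; _%_)
open import Data.Integer as ℤ using (ℤ; +_; -[1+_])
open import Data.Integer.DivMod using (_%ℕ_)
open import Data.Product using (_×_; _,_; proj₁; proj₂)
open import Data.Vec using (Vec; []; _∷_; zipWith; take; drop; replicate)
open import Data.List using (List; []; _∷_; map; concatMap; filter; foldr; length)
open import Data.Bool.ListAction using (any; all)
open import Relation.Binary.PropositionalEquality using (_≡_)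

Grp : ℕ → Set
Grp n = Vec Bool n

_⊞_ : ∀ {n} → Grp n → Grp n → Grp n
_⊞_ = zipWith _xor_

zeroG : ∀ {n} → Grp n
zeroG = replicate _ false

eqG : ∀ {n} → Grp n → Grp n → Bool
eqG [] [] = true
eqG (a ∷ x) (b ∷ y) = not (a xor b) ∧ eqG x y

vecsOf : ∀ {X : Set} → List X → (n : ℕ) → List (Vec X n)
vecsOf xs zero = [] ∷ []
vecsOf xs (suc n) = concatMap (λ a → map (a ∷_) (vecsOf xs n)) xs

elems : (n : ℕ) → List (Grp n)
elems n = vecsOf (false ∷ true ∷ []) n

card : ℕ → ℕ
card n = length (elems n)

-- quadratic form, value in quarters (q x = k means q(x) = k/4 in Q/Z)
QF : ℕ → Set
QF n = Grp n → ℕ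

eqQZ : ℕ → ℕ → Bool
eqQZ k l = (k % 4) ≡ᵇ (l % 4)

-- bilinear form (x,y) = q(x+y) - q(x) - q(y), in quarters (mod 4)
bil : ∀ {n} → QF n → Grp n → Grp n → ℕ
bil q x y = q (x ⊞ y) + 3 * q x + 3 * q y

A2 : ℤ → QF 1
A2 a (false ∷ []) = 0
A2 a (true ∷ []) = a %ℕ 4

-- V: (Z/2)^2, q(v1) = q(v2) = 1/2, (v1,v2) = 1/2 (hence q(v1+v2) = 1/2)
Vform : QF 2
Vform (false ∷ false ∷ []) = 0
Vform (true ∷ false ∷ []) = 2
Vform (false ∷ true ∷ []) = 2
Vform (true ∷ true ∷ []) = 2

_⊕Q_ : ∀ {m n} → QF m → QF n → QF (m + n)
(_⊕Q_ {m} q₁ q₂) x = q₁ (take m x) + q₂ (drop m x)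

_^⊕_ : ∀ {d} → QF d → (k : ℕ) → QF (k * d)
(q ^⊕ zero) _ = 0
(q ^⊕ suc k) = q ⊕Q (q ^⊕ k)

-- Group endomorphisms of (Z/2)^n are exactly the F2-linear maps, i.e. given by the
-- images of the standard basis vectors (columns).
Endo : ℕ → Set
Endo n = Vec (Grp n) n

apply : ∀ {n m} → Vec (Grp n) m → Grp m → Grp n
apply [] [] = zeroG
apply (c ∷ cs) (b ∷ x) = (if b then c else zeroG) ⊞ apply cs x

endos : (n : ℕ) → List (Endo n)
endos n = vecsOf (elems n) n

isIsometry : ∀ {n} → QF n → Endo n → Bool
isIsometry {n} q γ =
  all (λ x → all (λ y → not (eqG (apply γ x) (apply γ y)) ∨ eqG x y) (elems n)) (elems n)
  ∧ all (λ y → any (λ x → eqG (apply γ x) y) (elems n)) (elems n)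
  ∧ all (λ x → eqQZ (q (apply γ x)) (q x)) (elems n)

O : ∀ {n} → QF n → List (Endo n)
O {n} q = filter (λ γ → isIsometry q γ Data.Bool.≟ true) (endos n)
  where import Data.Bool

inOrbit : ∀ {n} → QF n → Grp n → Grp n → Bool
inOrbit q x y = any (λ γ → eqG (apply γ x) y) (O q)

reps : ∀ {n} → QF n → List (Grp n)
reps {n} q = go [] (elems n)
  where
  go : List (Grp n) → List (Grp n) → List (Grp n)
  go seen [] = []
  go seen (x ∷ xs) =
    if any (λ z → inOrbit q x z) seen then go (x ∷ seen) xs else x ∷ go (x ∷ seen) xs

-- Gaussian integers a + b i as pairs (exact here: e(k/4) = i^k)
ℤ[i] : Set
ℤ[i] = ℤ × ℤ

_+ᵍ_ : ℤ[i] → ℤ[i] → ℤ[i]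
(a , b) +ᵍ (c , d) = (a ℤ.+ c , b ℤ.+ d)

sumᵍ : List ℤ[i] → ℤ[i]
sumᵍ = foldr _+ᵍ_ (+ 0 , + 0)

eQ : ℕ → ℤ[i]
eQ zero = (+ 1 , + 0)
eQ (suc zero) = (+ 0 , + 1)
eQ (suc (suc zero)) = (-[1+ 0 ] , + 0)
eQ (suc (suc (suc zero))) = (+ 0 , -[1+ 0 ])
eQ (suc (suc (suc (suc k)))) = eQ k

G : ∀ {n} → QF n → ℤ[i]
G {n} q = sumᵍ (map (λ x →
            sumᵍ (map (λ y → eQ (bil q x y))
                      (filter (λ y → inOrbit q x y Data.Bool.≟ true) (elems n))))
          (reps q))
  where import Data.Bool

IsSqrt : ℤ[i] → ℕ → Set
IsSqrt (r , s) N = (s ≡ + 0) × (+ 0 ℤ.≤ r) × (r ℤ.* r ≡ + N)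

-- For |A| = 4 the group O(A) is found by enumerating End(A), and G(A, O(A)) is simply computed.
-- For (A_{2,a})^{⊕3} and (A_{2,a})^{⊕4} that enumeration is out of reach, so the orbits are
-- certified instead: the coordinate permutations are isometries, and any two elements that no
-- coordinate permutation links are told apart by the isometry invariants q(x) and [x = 0].  Hence
-- the O(A)-orbits are the weight classes, and the Gauss sum is evaluated over them.

module Submission where

open import Defs
open import Data.Bool using (Bool; true; false; T; not; _∧_; _∨_; _xor_; if_then_else_; _≟_)
open import Data.Bool.Properties using (T-∧; T-∨; T-≡; T-not-≡; xor-same; xor-identityʳ)
open import Data.Bool.ListAction using (any; all; or)
open import Data.Empty using (⊥-elim)
open import Data.Fin using (Fin; zero; suc)
open import Data.Integer using (ℤ; +_; -[1+_]; +≤+)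
open import Data.List using (List; []; _∷_; map; filter; concatMap; allFin)
open import Data.List.Properties using (map-cong; filter-≐)
open import Data.List.Relation.Unary.All as All using ()
open import Data.List.Relation.Unary.All.Properties using (all⁺)
open import Data.List.Relation.Unary.Any as Any using (here; there)
open import Data.List.Relation.Unary.Any.Properties using (any⁺; any⁻)
open import Data.List.Membership.Propositional using (_∈_; find)
open import Data.List.Membership.Propositional.Properties using (∈-map⁺; ∈-concatMap⁺; ∈-filter⁺; ∈-filter⁻)
open import Data.List.Relation.Binary.Subset.Propositional.Properties using (Any-resp-⊆)
open import Data.Nat as ℕ using (ℕ; _*_; z≤n)
open import Data.Nat.Properties using (*-identityʳ)
open import Data.Product using (_×_; _,_; proj₁; proj₂)
open import Data.Sum using (_⊎_; inj₁; inj₂)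
open import Data.Vec as Vec using (Vec; []; _∷_; insertAt; _[_]≔_)
open import Data.Vec.Properties using (zipWith-identityʳ)
open import Function using (_∘_; Equivalence)
open import Relation.Binary.PropositionalEquality using (_≡_; refl; sym; trans; cong; cong₂; subst)
open import Relation.Nullary using (¬_)

T-⇔→≡ : ∀ {b c} → (T b → T c) → (T c → T b) → b ≡ c
T-⇔→≡ {false} {false} _   _   = refl
T-⇔→≡ {false} {true}  _   c⇒b = ⊥-elim (c⇒b _)
T-⇔→≡ {true}  {false} b⇒c _   = ⊥-elim (b⇒c _)
T-⇔→≡ {true}  {true}  _   _   = refl

∈-vecsOf : ∀ {X : Set} {xs : List X} → (∀ x → x ∈ xs) → ∀ {n} (v : Vec X n) → v ∈ vecsOf xs n
∈-vecsOf all∈ []      = here refl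
∈-vecsOf all∈ (x ∷ v) = ∈-concatMap⁺ _ (Any.map (λ { refl → ∈-map⁺ (x ∷_) (∈-vecsOf all∈ v) }) (all∈ x))

∈-elems : ∀ {n} (x : Grp n) → x ∈ elems n
∈-elems = ∈-vecsOf λ { false → here refl ; true → there (here refl) }

∈-endos : ∀ {n} (γ : Endo n) → γ ∈ endos n
∈-endos = ∈-vecsOf ∈-elems

T-all-elems : ∀ {n} {p : Grp n → Bool} → T (all p (elems n)) → ∀ x → T (p x)
T-all-elems h x = All.lookup (all⁺ _ _ h) (∈-elems x)

eqG-sound : ∀ {n} {x y : Grp n} → T (eqG x y) → x ≡ y
eqG-sound {x = []}        {[]}        _ = refl
eqG-sound {x = false ∷ x} {false ∷ y} h = cong (false ∷_) (eqG-sound h)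
eqG-sound {x = true ∷ x}  {true ∷ y}  h = cong (true ∷_) (eqG-sound h)

eqG-complete : ∀ {n} {x y : Grp n} → x ≡ y → T (eqG x y)
eqG-complete {x = []}        refl = _
eqG-complete {x = false ∷ x} refl = eqG-complete {x = x} refl
eqG-complete {x = true ∷ x}  refl = eqG-complete {x = x} refl

apply-zeroG : ∀ {n m} (γ : Vec (Grp n) m) → apply γ zeroG ≡ zeroG
apply-zeroG []       = refl
apply-zeroG (c ∷ cs) rewrite apply-zeroG cs = zipWith-identityʳ xor-identityʳ zeroG

separated : ∀ {n} → QF n → Grp n → Grp n → Bool
separated q x y = not (eqQZ (q y) (q x)) ∨ (eqG x zeroG xor eqG y zeroG)

module _ {n} (q : QF n) (γ : Endo n) (iso : T (isIsometry q γ)) where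

  isometry-injective : ∀ {x y} → apply γ x ≡ apply γ y → x ≡ y
  isometry-injective {x} {y} γx≡γy =
    eqG-sound (subst (λ b → T (not b ∨ eqG x y)) (Equivalence.to T-≡ (eqG-complete γx≡γy))
                     (T-all-elems (T-all-elems (proj₁ (Equivalence.to (T-∧ {all _ (elems n)}) iso)) x) y))

  isometry-preserves-q : ∀ x → T (eqQZ (q (apply γ x)) (q x))
  isometry-preserves-q =
    T-all-elems (proj₂ (Equivalence.to (T-∧ {all _ (elems n)}) (proj₂ (Equivalence.to (T-∧ {all _ (elems n)}) iso))))

  isometry-preserves-zero : ∀ x → eqG (apply γ x) zeroG ≡ eqG x zeroG
  isometry-preserves-zero x = T-⇔→≡
    (λ γx≡0 → eqG-complete (isometry-injective (trans (eqG-sound γx≡0) (sym (apply-zeroG γ)))))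
    (λ x≡0 → eqG-complete (trans (cong (apply γ) (eqG-sound x≡0)) (apply-zeroG γ)))

  isometry-not-separated : ∀ x → ¬ T (separated q x (apply γ x))
  isometry-not-separated x sep with Equivalence.to T-∨ sep
  ... | inj₁ q-differs    = subst T (Equivalence.to T-not-≡ q-differs) (isometry-preserves-q x)
  ... | inj₂ zero-differs =
    subst T (trans (cong (eqG x zeroG xor_) (isometry-preserves-zero x)) (xor-same (eqG x zeroG))) zero-differs

module _ {n} (q : QF n) {γ : Endo n} where

  isometry⇒∈O : T (isIsometry q γ) → γ ∈ O q
  isometry⇒∈O iso = ∈-filter⁺ (λ γ → isIsometry q γ ≟ true) (∈-endos γ) (Equivalence.to T-≡ iso)

  ∈O⇒isometry : γ ∈ O q → T (isIsometry q γ)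
  ∈O⇒isometry γ∈O = Equivalence.from T-≡ (proj₂ (∈-filter⁻ (λ γ → isIsometry q γ ≟ true) {xs = endos n} γ∈O))

orbitOf : ∀ {n} → List (Endo n) → Grp n → Grp n → Bool
orbitOf Ws x y = any (λ γ → eqG (apply γ x) y) Ws

-- Ws need not be a group: it only has to link, in one step, any two elements that separated does not tell apart.
isOrbitCertificate : ∀ {n} → QF n → List (Endo n) → Bool
isOrbitCertificate {n} q Ws =
  all (isIsometry q) Ws ∧ all (λ x → all (λ y → orbitOf Ws x y ∨ separated q x y) (elems n)) (elems n)

inOrbit-by-certificate : ∀ {n} (q : QF n) (Ws : List (Endo n)) → T (isOrbitCertificate q Ws) →
                         ∀ x y → inOrbit q x y ≡ orbitOf Ws x y
inOrbit-by-certificate {n} q Ws cert x y = T-⇔→≡ O⇒Ws Ws⇒O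
  where
  Ws-isometries : ∀ {γ} → γ ∈ Ws → T (isIsometry q γ)
  Ws-isometries = All.lookup (all⁺ (isIsometry q) Ws (proj₁ (Equivalence.to (T-∧ {all _ Ws}) cert)))

  linked-or-separated : T (orbitOf Ws x y ∨ separated q x y)
  linked-or-separated = T-all-elems (T-all-elems (proj₂ (Equivalence.to (T-∧ {all _ Ws}) cert)) x) y

  O⇒Ws : T (inOrbit q x y) → T (orbitOf Ws x y)
  O⇒Ws h with find (any⁻ _ (O q) h) | Equivalence.to T-∨ linked-or-separated
  ... | _               | inj₁ linked = linked
  ... | γ , γ∈O , γx≡y | inj₂ sep    =
    ⊥-elim (isometry-not-separated q γ (∈O⇒isometry q γ∈O) x (subst (T ∘ separated q x) (sym (eqG-sound γx≡y)) sep))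

  Ws⇒O : T (orbitOf Ws x y) → T (inOrbit q x y)
  Ws⇒O h = any⁺ _ (Any-resp-⊆ (isometry⇒∈O q ∘ Ws-isometries) (any⁻ _ Ws h))

orbitSum : ∀ {n} → QF n → (Grp n → Grp n → Bool) → Grp n → ℤ[i]
orbitSum {n} q R x = sumᵍ (map (λ y → eQ (bil q x y)) (filter (λ y → R x y ≟ true) (elems n)))

orbitReps : ∀ {n} → (Grp n → Grp n → Bool) → List (Grp n) → List (Grp n) → List (Grp n)
orbitReps R seen []       = []
orbitReps R seen (x ∷ xs) =
  if any (λ z → R x z) seen then orbitReps R (x ∷ seen) xs else x ∷ orbitReps R (x ∷ seen) xs

gaussSum : ∀ {n} → QF n → (Grp n → Grp n → Bool) → ℤ[i]
gaussSum {n} q R = sumᵍ (map (orbitSum q R) (orbitReps R [] (elems n)))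

orbitSum-cong : ∀ {n} (q : QF n) {R S : Grp n → Grp n → Bool} → (∀ x y → R x y ≡ S x y) →
                ∀ x → orbitSum q R x ≡ orbitSum q S x
orbitSum-cong {n} q R≗S x = cong (sumᵍ ∘ map _)
  (filter-≐ (λ y → _ ≟ true) (λ y → _ ≟ true) ((λ {y} → trans (sym (R≗S x y))) , (λ {y} → trans (R≗S x y))) (elems n))

RepsUnfold : ℕ → Set
RepsUnfold n = (q : QF n) (R : Grp n → Grp n → Bool) → (∀ x y → inOrbit q x y ≡ R x y) →
               reps q ≡ orbitReps R [] (elems n)

G-by-certificate : ∀ {n} (q : QF n) → RepsUnfold n → (Ws : List (Endo n)) → T (isOrbitCertificate q Ws) →
                   G q ≡ gaussSum q (orbitOf Ws)
G-by-certificate {n} q unfold Ws cert = trans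
  (cong (sumᵍ ∘ map (orbitSum q (inOrbit q))) (unfold q (orbitOf Ws) inOrbit≗Ws))
  (cong sumᵍ (map-cong (orbitSum-cong q inOrbit≗Ws) (orbitReps (orbitOf Ws) [] (elems n))))
  where
  inOrbit≗Ws : ∀ x y → inOrbit q x y ≡ orbitOf Ws x y
  inOrbit≗Ws = inOrbit-by-certificate q Ws cert

-- reps q is computed by a local function of Defs, which cannot be named; it is unfolded one element
-- at a time.  The elements are spelled out as literals so that each step matches the goal
-- syntactically: otherwise every step normalises inOrbit q, and a single refl is exponential in |A|.
module Unfolding {n} (q : QF n) (R : Grp n → Grp n → Bool) (inOrbit≗R : ∀ x y → inOrbit q x y ≡ R x y) where

  unfold-at : (x : Grp n) (seen : List (Grp n)) {l l′ : List (Grp n)} → l ≡ l′ →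
              (if any (λ z → inOrbit q x z) seen then l else x ∷ l) ≡ (if any (λ z → R x z) seen then l′ else x ∷ l′)
  unfold-at x seen = cong₂ (λ c l → if c then l else x ∷ l) (cong or (map-cong (inOrbit≗R x) seen))

module Grp₃ where
  pattern e₀ = false ∷ false ∷ false ∷ []
  pattern e₁ = false ∷ false ∷ true ∷ []
  pattern e₂ = false ∷ true ∷ false ∷ []
  pattern e₃ = false ∷ true ∷ true ∷ []
  pattern e₄ = true ∷ false ∷ false ∷ []
  pattern e₅ = true ∷ false ∷ true ∷ []
  pattern e₆ = true ∷ true ∷ false ∷ []
  pattern e₇ = true ∷ true ∷ true ∷ []

module Grp₄ where
  pattern e₀ = false ∷ false ∷ false ∷ false ∷ []
  pattern e₁ = false ∷ false ∷ false ∷ true ∷ []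
  pattern e₂ = false ∷ false ∷ true ∷ false ∷ []
  pattern e₃ = false ∷ false ∷ true ∷ true ∷ []
  pattern e₄ = false ∷ true ∷ false ∷ false ∷ []
  pattern e₅ = false ∷ true ∷ false ∷ true ∷ []
  pattern e₆ = false ∷ true ∷ true ∷ false ∷ []
  pattern e₇ = false ∷ true ∷ true ∷ true ∷ []
  pattern e₈ = true ∷ false ∷ false ∷ false ∷ []
  pattern e₉ = true ∷ false ∷ false ∷ true ∷ []
  pattern e₁₀ = true ∷ false ∷ true ∷ false ∷ []
  pattern e₁₁ = true ∷ false ∷ true ∷ true ∷ []
  pattern e₁₂ = true ∷ true ∷ false ∷ false ∷ []
  pattern e₁₃ = true ∷ true ∷ false ∷ true ∷ []
  pattern e₁₄ = true ∷ true ∷ true ∷ false ∷ []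
  pattern e₁₅ = true ∷ true ∷ true ∷ true ∷ []

reps-unfold₃ : RepsUnfold 3
reps-unfold₃ q R inOrbit≗R =
  unfold-at e₀ [] (
  unfold-at e₁ (e₀ ∷ []) (
  unfold-at e₂ (e₁ ∷ e₀ ∷ []) (
  unfold-at e₃ (e₂ ∷ e₁ ∷ e₀ ∷ []) (
  unfold-at e₄ (e₃ ∷ e₂ ∷ e₁ ∷ e₀ ∷ []) (
  unfold-at e₅ (e₄ ∷ e₃ ∷ e₂ ∷ e₁ ∷ e₀ ∷ []) (
  unfold-at e₆ (e₅ ∷ e₄ ∷ e₃ ∷ e₂ ∷ e₁ ∷ e₀ ∷ []) (
  unfold-at e₇ (e₆ ∷ e₅ ∷ e₄ ∷ e₃ ∷ e₂ ∷ e₁ ∷ e₀ ∷ []) (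
  refl))))))))
  where open Unfolding q R inOrbit≗R
        open Grp₃

reps-unfold₄ : RepsUnfold 4
reps-unfold₄ q R inOrbit≗R =
  unfold-at e₀ [] (
  unfold-at e₁ (e₀ ∷ []) (
  unfold-at e₂ (e₁ ∷ e₀ ∷ []) (
  unfold-at e₃ (e₂ ∷ e₁ ∷ e₀ ∷ []) (
  unfold-at e₄ (e₃ ∷ e₂ ∷ e₁ ∷ e₀ ∷ []) (
  unfold-at e₅ (e₄ ∷ e₃ ∷ e₂ ∷ e₁ ∷ e₀ ∷ []) (
  unfold-at e₆ (e₅ ∷ e₄ ∷ e₃ ∷ e₂ ∷ e₁ ∷ e₀ ∷ []) (
  unfold-at e₇ (e₆ ∷ e₅ ∷ e₄ ∷ e₃ ∷ e₂ ∷ e₁ ∷ e₀ ∷ []) (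
  unfold-at e₈ (e₇ ∷ e₆ ∷ e₅ ∷ e₄ ∷ e₃ ∷ e₂ ∷ e₁ ∷ e₀ ∷ []) (
  unfold-at e₉ (e₈ ∷ e₇ ∷ e₆ ∷ e₅ ∷ e₄ ∷ e₃ ∷ e₂ ∷ e₁ ∷ e₀ ∷ []) (
  unfold-at e₁₀ (e₉ ∷ e₈ ∷ e₇ ∷ e₆ ∷ e₅ ∷ e₄ ∷ e₃ ∷ e₂ ∷ e₁ ∷ e₀ ∷ []) (
  unfold-at e₁₁ (e₁₀ ∷ e₉ ∷ e₈ ∷ e₇ ∷ e₆ ∷ e₅ ∷ e₄ ∷ e₃ ∷ e₂ ∷ e₁ ∷ e₀ ∷ []) (
  unfold-at e₁₂ (e₁₁ ∷ e₁₀ ∷ e₉ ∷ e₈ ∷ e₇ ∷ e₆ ∷ e₅ ∷ e₄ ∷ e₃ ∷ e₂ ∷ e₁ ∷ e₀ ∷ []) (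
  unfold-at e₁₃ (e₁₂ ∷ e₁₁ ∷ e₁₀ ∷ e₉ ∷ e₈ ∷ e₇ ∷ e₆ ∷ e₅ ∷ e₄ ∷ e₃ ∷ e₂ ∷ e₁ ∷ e₀ ∷ []) (
  unfold-at e₁₄ (e₁₃ ∷ e₁₂ ∷ e₁₁ ∷ e₁₀ ∷ e₉ ∷ e₈ ∷ e₇ ∷ e₆ ∷ e₅ ∷ e₄ ∷ e₃ ∷ e₂ ∷ e₁ ∷ e₀ ∷ []) (
  unfold-at e₁₅ (e₁₄ ∷ e₁₃ ∷ e₁₂ ∷ e₁₁ ∷ e₁₀ ∷ e₉ ∷ e₈ ∷ e₇ ∷ e₆ ∷ e₅ ∷ e₄ ∷ e₃ ∷ e₂ ∷ e₁ ∷ e₀ ∷ []) (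
  refl))))))))))))))))
  where open Unfolding q R inOrbit≗R
        open Grp₄

-- _^⊕_ gives (A_{2,a})^{⊕k} the size k * 1.  Transporting to it keeps the instances below from
-- comparing reps {4} with reps {4 * 1}, which would unfold reps.
reps-unfold-*1 : ∀ k → RepsUnfold k → RepsUnfold (k * 1)
reps-unfold-*1 k = subst RepsUnfold (sym (*-identityʳ k))

permutations : (n : ℕ) → List (Vec (Fin n) n)
permutations ℕ.zero    = [] ∷ []
permutations (ℕ.suc n) =
  concatMap (λ σ → map (λ i → insertAt (Vec.map suc σ) i zero) (allFin (ℕ.suc n))) (permutations n)

basis : ∀ {n} → Fin n → Grp n
basis i = zeroG [ i ]≔ true

coordinatePermutations : (n : ℕ) → List (Endo n)
coordinatePermutations n = map (Vec.map basis) (permutations n)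

G-V : G Vform ≡ (+ 0 , + 0)
G-V = refl

G-A2₁⊕A2₋₁ : G (A2 (+ 1) ⊕Q A2 -[1+ 0 ]) ≡ (+ 0 , + 0)
G-A2₁⊕A2₋₁ = refl

G-A2² : ∀ a → a ≡ + 1 ⊎ a ≡ -[1+ 0 ] → G (A2 a ^⊕ 2) ≡ (+ 2 , + 0)
G-A2² _ (inj₁ refl) = refl
G-A2² _ (inj₂ refl) = refl

G-A2³ : ∀ a → a ≡ + 1 ⊎ a ≡ -[1+ 0 ] → G (A2 a ^⊕ 3) ≡ (+ 0 , + 0)
G-A2³ _ (inj₁ refl) = G-by-certificate (A2 (+ 1) ^⊕ 3) (reps-unfold-*1 3 reps-unfold₃) (coordinatePermutations 3) _
G-A2³ _ (inj₂ refl) = G-by-certificate (A2 -[1+ 0 ] ^⊕ 3) (reps-unfold-*1 3 reps-unfold₃) (coordinatePermutations 3) _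

G-A2⁴ : ∀ a → a ≡ + 1 ⊎ a ≡ -[1+ 0 ] → G (A2 a ^⊕ 4) ≡ (+ 4 , + 0)
G-A2⁴ _ (inj₁ refl) = G-by-certificate (A2 (+ 1) ^⊕ 4) (reps-unfold-*1 4 reps-unfold₄) (coordinatePermutations 4) _
G-A2⁴ _ (inj₂ refl) = G-by-certificate (A2 -[1+ 0 ] ^⊕ 4) (reps-unfold-*1 4 reps-unfold₄) (coordinatePermutations 4) _

proposition4p5 : (a : ℤ) → (a ≡ + 1 ⊎ a ≡ -[1+ 0 ]) →
    (G Vform ≡ (+ 0 , + 0))
    × (G (A2 (+ 1) ⊕Q A2 -[1+ 0 ]) ≡ (+ 0 , + 0))
    × (G (A2 a ^⊕ 3) ≡ (+ 0 , + 0))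
    × IsSqrt (G (A2 a ^⊕ 2)) (card 2)
    × IsSqrt (G (A2 a ^⊕ 4)) (card 4)
proposition4p5 a a≡±1 =
  G-V , G-A2₁⊕A2₋₁ , G-A2³ a a≡±1 ,
  subst (λ z → IsSqrt z (card 2)) (sym (G-A2² a a≡±1)) (refl , +≤+ z≤n , refl) ,
  subst (λ z → IsSqrt z (card 4)) (sym (G-A2⁴ a a≡±1)) (refl , +≤+ z≤n , refl)
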